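{- Let $k\ge 3$ be an integer and, for positive integers $m$, let $T(k,m)=\frac{(k-2)m(m-1)}{2}+m$ be the $m$-th $k$-gonal number. For a positive integer $n$ put $s=\left\lfloor\sqrt{\frac{2n}{k-2}}\right\rfloor$. Then the $n$-th smallest positive integer not of the form $T(k,m)$ ($m\ge 1$) equals $$a(n)=\begin{cases} n+s+1 & \text{if } 2n>(k-2)s(s+1),\\ n+s & \text{otherwise.}\end{cases}$$ Moreover, for $3\le k\le 10$ this equals $n+\left\lfloor\sqrt{\frac{2n}{k-2}}+\frac{1}{2}\right\rfloor$. -}

module Defs where

open import Data.Nat using (ℕ; zero; suc; _+_; _*_; _∸_; _≤_; _<_)
open import Data.Nat.DivMod using (_/_)
open import Data.Fin using (Fin; fromℕ)
open import Data.Product using (Σ; ∃; _×_)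
open import Data.Empty using (⊥)
open import Relation.Nullary using (¬_)
open import Relation.Binary.PropositionalEquality using (_≡_)

-- m-th k-gonal number T(k,m) = (k-2) m (m-1) / 2 + m  (the division is exact)
T : ℕ → ℕ → ℕ
T k m = ((k ∸ 2) * m * (m ∸ 1)) / 2 + m

Polygonal : ℕ → ℕ → Set
Polygonal k x = Σ ℕ λ m → 1 ≤ m × T k m ≡ x

NonPolygonal : ℕ → ℕ → Set
NonPolygonal k x = 1 ≤ x × ¬ Polygonal k x

-- NthSmallest P n x : x is the n-th smallest (n ≥ 1, 1-indexed) natural number satisfying P.
-- Witnessed by the strictly increasing enumeration f of all elements of P up to x,
-- with f (last) = x.
NthSmallest : (ℕ → Set) → ℕ → ℕ → Set
NthSmallest P zero    x = ⊥
NthSmallest P (suc n) x =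
  Σ (Fin (suc n) → ℕ) λ f →
    (∀ i j → Data.Fin._<_ i j → f i < f j)
    × (∀ i → P (f i))
    × (∀ y → P y → y ≤ x → ∃ λ i → f i ≡ y)
    × f (fromℕ n) ≡ x

-- s = ⌊ √(2n/(k-2)) ⌋, characterised (for k ≥ 3) by (k-2)s² ≤ 2n < (k-2)(s+1)²
IsFloorSqrt : ℕ → ℕ → ℕ → Set
IsFloorSqrt k n s = (k ∸ 2) * (s * s) ≤ 2 * n × 2 * n < (k ∸ 2) * (suc s * suc s)

-- t = ⌊ √(2n/(k-2)) + 1/2 ⌋, characterised (for k ≥ 3) by
-- t ≤ √(2n/(k-2)) + 1/2 < t + 1, i.e. (k-2)(2t-1)² ≤ 8n < (k-2)(2t+1)²
-- (for t = 0 the left condition is vacuous, matching 2*0 ∸ 1 = 0).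
IsFloorSqrtHalf : ℕ → ℕ → ℕ → Set
IsFloorSqrtHalf k n t =
  (k ∸ 2) * ((2 * t ∸ 1) * (2 * t ∸ 1)) ≤ 8 * n
  × 8 * n < (k ∸ 2) * ((2 * t + 1) * (2 * t + 1))

a : ℕ → ℕ → ℕ → ℕ
a k n s with (k ∸ 2) * s * (s + 1) Data.Nat.<? 2 * n
... | Relation.Nullary.yes _ = n + s + 1
... | Relation.Nullary.no  _ = n + s

{-# OPTIONS --safe #-}
module Submission where

-- With d = k − 2 the polygonal numbers satisfy T(m+1) = T(m) + d·m + 1, so exactly d·m
-- non-polygonal numbers lie strictly between T(m) and T(m+1), and gapSum d m = d·m(m−1)/2 of
-- them lie below T(m). Counting upwards, for gapSum d m < n ≤ gapSum d (m+1) the n-th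
-- non-polygonal number is T(m) + (n − gapSum d m) = n + m. The floor conditions pin down m:
-- doubled, they give d·m(m−1) < 2n ≤ d·m(m+1) for m = s+1 or m = s according to the case
-- of a(n). For m = t, the bound 8n < d(2t+1)² = 4d·t(t+1) + d yields n ≤ gapSum d (t+1)
-- only because d ≤ 8.

open import Defs
open import Data.Nat using (ℕ; zero; suc; _+_; _*_; _∸_; _≤_; _<_; _≤′_; ≤′-refl; ≤′-step; z≤n; s≤s; _<?_; >-nonZero)
open import Data.Nat.Properties
open import Data.Nat.DivMod using (_/_; m*n/n≡m)
open import Data.Nat.Tactic.RingSolver using (solve)
open import Data.List.Base using (_∷_; [])
open import Data.Fin using (toℕ; fromℕ<)
open import Data.Fin.Properties using (toℕ<n; toℕ-fromℕ; toℕ-fromℕ<)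
open import Data.Product using (∃; _×_; _,_)
open import Data.Sum using (inj₁; inj₂)
open import Function using (_∘_)
open import Relation.Nullary using (¬_; yes; no; contradiction)
open import Relation.Binary.Core using (_Preserves_⟶_)
open import Relation.Binary.PropositionalEquality

record Enumeration (P : ℕ → Set) (n x : ℕ) : Set where
  field
    elem       : ℕ → ℕ
    increasing : ∀ {i j} → i < j → j < n → elem i < elem j
    valid      : ∀ {i} → i < n → P (elem i)
    bounded    : ∀ {i} → i < n → elem i ≤ x
    complete   : ∀ y → P y → y ≤ x → ∃ λ i → i < n × elem i ≡ y

module _ {P : ℕ → Set} where

  enumeration-zero : ¬ P 0 → Enumeration P 0 0
  enumeration-zero ¬P0 = record
    { elem       = λ _ → 0
    ; increasing = λ _ ()
    ; valid      = λ ()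
    ; bounded    = λ ()
    ; complete   = λ y Py y≤0 → contradiction (subst P (n≤0⇒n≡0 y≤0) Py) ¬P0
    }

  enumeration-skip : ∀ {n x} → Enumeration P n x → ¬ P (suc x) → Enumeration P n (suc x)
  enumeration-skip {n} {x} e ¬Px+1 = record
    { Enumeration e
    ; bounded  = m≤n⇒m≤1+n ∘ bounded
    ; complete = complete′
    }
    where
    open Enumeration e
    complete′ : ∀ y → P y → y ≤ suc x → ∃ λ i → i < n × elem i ≡ y
    complete′ y Py y≤x+1 with m≤n⇒m<n∨m≡n y≤x+1
    ... | inj₁ y<x+1 = complete y Py (≤-pred y<x+1)
    ... | inj₂ refl  = contradiction Py ¬Px+1

  enumeration-snoc : ∀ {n x} → Enumeration P n x → P (suc x) → Enumeration P (suc n) (suc x)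
  enumeration-snoc {n} {x} e Px+1 = record
    { elem       = elem′
    ; increasing = increasing′
    ; valid      = valid′
    ; bounded    = bounded′
    ; complete   = complete′
    }
    where
    open Enumeration e
    elem′ : ℕ → ℕ
    elem′ i with i <? n
    ... | yes _ = elem i
    ... | no  _ = suc x

    elem′-< : ∀ {i} → i < n → elem′ i ≡ elem i
    elem′-< {i} i<n with i <? n
    ... | yes _   = refl
    ... | no  i≮n = contradiction i<n i≮n

    elem′-last : elem′ n ≡ suc x
    elem′-last with n <? n
    ... | yes n<n = contradiction n<n (<-irrefl refl)
    ... | no  _   = refl

    increasing′ : ∀ {i j} → i < j → j < suc n → elem′ i < elem′ j
    increasing′ {i} {j} i<j j<n+1 with i <? n | j <? n
    ... | yes _   | yes j<n = increasing i<j j<n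
    ... | yes i<n | no  _   = s≤s (bounded i<n)
    ... | no  i≮n | _       = contradiction (<-≤-trans i<j (≤-pred j<n+1)) i≮n

    valid′ : ∀ {i} → i < suc n → P (elem′ i)
    valid′ {i} _ with i <? n
    ... | yes i<n = valid i<n
    ... | no  _   = Px+1

    bounded′ : ∀ {i} → i < suc n → elem′ i ≤ suc x
    bounded′ {i} _ with i <? n
    ... | yes i<n = m≤n⇒m≤1+n (bounded i<n)
    ... | no  _   = ≤-refl

    complete′ : ∀ y → P y → y ≤ suc x → ∃ λ i → i < suc n × elem′ i ≡ y
    complete′ y Py y≤x+1 with m≤n⇒m<n∨m≡n y≤x+1
    ... | inj₂ refl  = n , ≤-refl , elem′-last
    ... | inj₁ y<x+1 with complete y Py (≤-pred y<x+1)
    ...   | i , i<n , elemᵢ≡y = i , m<n⇒m<1+n i<n , trans (elem′-< i<n) elemᵢ≡y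

  enumeration-last : ∀ {n x} (e : Enumeration P (suc n) x) → P x → Enumeration.elem e n ≡ x
  enumeration-last {n} {x} e Px with Enumeration.complete e x Px ≤-refl
  ... | i , i<n+1 , elemᵢ≡x with m≤n⇒m<n∨m≡n (≤-pred i<n+1)
  ...   | inj₂ refl = elemᵢ≡x
  ...   | inj₁ i<n  = contradiction (increasing i<n ≤-refl)
                        (≤⇒≯ (subst (elem n ≤_) (sym elemᵢ≡x) (bounded ≤-refl)))
    where open Enumeration e

  enumeration⇒nthSmallest : ∀ {n x} → Enumeration P (suc n) x → P x → NthSmallest P (suc n) x
  enumeration⇒nthSmallest {n} {x} e Px =
      elem ∘ toℕ
    , (λ i j i<j → increasing i<j (toℕ<n j))
    , (λ i → valid (toℕ<n i))
    , complete′
    , trans (cong elem (toℕ-fromℕ n)) (enumeration-last e Px)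
    where
    open Enumeration e
    complete′ : ∀ y → P y → y ≤ x → ∃ λ i → elem (toℕ i) ≡ y
    complete′ y Py y≤x with complete y Py y≤x
    ... | i , i<n+1 , elemᵢ≡y = fromℕ< i<n+1 , trans (cong elem (toℕ-fromℕ< i<n+1)) elemᵢ≡y

stepwise-monotone : (f : ℕ → ℕ) → (∀ m → f m ≤ f (suc m)) → f Preserves _≤_ ⟶ _≤_
stepwise-monotone f f-step = mono ∘ ≤⇒≤′
  where
  mono : ∀ {i j} → i ≤′ j → f i ≤ f j
  mono ≤′-refl        = ≤-refl
  mono (≤′-step i≤′j) = ≤-trans (mono i≤′j) (f-step _)

between-values⇒≢ : (f : ℕ → ℕ) → f Preserves _≤_ ⟶ _≤_ →
                   ∀ {m x} → f m < x → x < f (suc m) → ∀ i → f i ≢ x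
between-values⇒≢ f mono {m} fm<x x<fm+1 i fi≡x with ≤-<-connex i m
... | inj₁ i≤m = <-irrefl fi≡x (≤-<-trans (mono i≤m) fm<x)
... | inj₂ m<i = <-irrefl (sym fi≡x) (<-≤-trans x<fm+1 (mono m<i))

gapSum : ℕ → ℕ → ℕ
gapSum d zero    = 0
gapSum d (suc m) = d * m + gapSum d m

double-gapSum : ∀ d m → 2 * gapSum d (suc m) ≡ d * (suc m * m)
double-gapSum d zero    = begin 2 * (d * 0 + 0) ≡⟨ solve (d ∷ []) ⟩ d * (1 * 0) ∎
  where open ≡-Reasoning
double-gapSum d (suc m) = begin
  2 * (d * suc m + gapSum d (suc m))      ≡⟨ *-distribˡ-+ 2 (d * suc m) _ ⟩
  2 * (d * suc m) + 2 * gapSum d (suc m)  ≡⟨ cong (2 * (d * suc m) +_) (double-gapSum d m) ⟩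
  2 * (d * suc m) + d * (suc m * m)       ≡⟨ solve (d ∷ m ∷ []) ⟩
  d * (suc (suc m) * suc m)               ∎
  where open ≡-Reasoning

T≡gapSum+m : ∀ k m → T k m ≡ gapSum (k ∸ 2) m + m
T≡gapSum+m k zero    = cong (λ z → z / 2 + 0) (*-zeroʳ ((k ∸ 2) * 0))
T≡gapSum+m k (suc m) = cong (_+ suc m) (begin
  ((k ∸ 2) * suc m * m) / 2        ≡⟨ cong (_/ 2) (*-assoc (k ∸ 2) (suc m) m) ⟩
  ((k ∸ 2) * (suc m * m)) / 2      ≡⟨ cong (_/ 2) (double-gapSum (k ∸ 2) m) ⟨
  (2 * gapSum (k ∸ 2) (suc m)) / 2 ≡⟨ cong (_/ 2) (*-comm 2 (gapSum (k ∸ 2) (suc m))) ⟩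
  (gapSum (k ∸ 2) (suc m) * 2) / 2 ≡⟨ m*n/n≡m (gapSum (k ∸ 2) (suc m)) 2 ⟩
  gapSum (k ∸ 2) (suc m)           ∎)
  where open ≡-Reasoning

gapSum-suc< : ∀ d m n → d * (suc m * m) < 2 * n → gapSum d (suc m) < n
gapSum-suc< d m n lt = *-cancelˡ-< 2 _ _ (subst (_< 2 * n) (sym (double-gapSum d m)) lt)

≤gapSum-suc : ∀ d m n → 2 * n ≤ d * (suc m * m) → n ≤ gapSum d (suc m)
≤gapSum-suc d m n le = *-cancelˡ-≤ 2 (subst (2 * n ≤_) (sym (double-gapSum d m)) le)

module _ (k : ℕ) where

  private
    d : ℕ
    d = k ∸ 2

  T-suc : ∀ m → T k (suc m) ≡ suc (d * m + T k m)
  T-suc m = begin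
    T k (suc m)                    ≡⟨ T≡gapSum+m k (suc m) ⟩
    d * m + gapSum d m + suc m     ≡⟨ +-suc (d * m + gapSum d m) m ⟩
    suc (d * m + gapSum d m + m)   ≡⟨ cong suc (+-assoc (d * m) (gapSum d m) m) ⟩
    suc (d * m + (gapSum d m + m)) ≡⟨ cong (λ z → suc (d * m + z)) (T≡gapSum+m k m) ⟨
    suc (d * m + T k m)            ∎
    where open ≡-Reasoning

  T-monotone : T k Preserves _≤_ ⟶ _≤_
  T-monotone = stepwise-monotone (T k) λ m →
    subst (T k m ≤_) (sym (T-suc m)) (m≤n⇒m≤1+n (m≤n+m (T k m) (d * m)))

  nonPolygonal-between : ∀ m r → 1 ≤ r → r ≤ d * m → NonPolygonal k (r + T k m)
  nonPolygonal-between m r 1≤r r≤dm =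
      ≤-trans 1≤r (m≤m+n r (T k m))
    , λ (i , _ , Tᵢ≡) → between-values⇒≢ (T k) T-monotone (m<n+m (T k m) 1≤r) below-next i Tᵢ≡
    where
    below-next : r + T k m < T k (suc m)
    below-next = subst (r + T k m <_) (sym (T-suc m)) (s≤s (+-monoˡ-≤ (T k m) r≤dm))

  ¬nonPolygonal-T : ∀ m → ¬ NonPolygonal k (T k (suc m))
  ¬nonPolygonal-T m (_ , ¬polygonal) = ¬polygonal (suc m , s≤s z≤n , refl)

  enumeration-block : ∀ m r → r ≤ d * m → Enumeration (NonPolygonal k) (r + gapSum d m) (r + T k m)
  enumeration-block zero    zero    _ =
    subst (Enumeration (NonPolygonal k) 0) (sym (T≡gapSum+m k 0)) (enumeration-zero λ { (() , _) })
  enumeration-block (suc m) zero    _ =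
    subst (Enumeration (NonPolygonal k) (d * m + gapSum d m)) (sym (T-suc m))
      (enumeration-skip (enumeration-block m (d * m) ≤-refl)
        (subst (¬_ ∘ NonPolygonal k) (T-suc m) (¬nonPolygonal-T m)))
  enumeration-block m       (suc r) r<dm =
    enumeration-snoc (enumeration-block m r (<⇒≤ r<dm)) (nonPolygonal-between m (suc r) (s≤s z≤n) r<dm)

  nthNonPolygonal : ∀ m n → gapSum d m < n → n ≤ gapSum d (suc m) → NthSmallest (NonPolygonal k) n (n + m)
  nthNonPolygonal m n c<n n≤c′ with m≤n⇒∃[o]m+o≡n c<n
  ... | r , refl =
    subst₂ (NthSmallest (NonPolygonal k)) (cong suc (+-comm r c)) last≡
      (enumeration⇒nthSmallest (enumeration-block m (suc r) r<dm)
        (nonPolygonal-between m (suc r) (s≤s z≤n) r<dm))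
    where
    c : ℕ
    c = gapSum d m
    r<dm : r < d * m
    r<dm = +-cancelʳ-≤ c (suc r) (d * m) (subst (_≤ d * m + c) (cong suc (+-comm c r)) n≤c′)
    last≡ : suc r + T k m ≡ suc (c + r) + m
    last≡ = cong suc (begin
      r + T k m   ≡⟨ cong (r +_) (T≡gapSum+m k m) ⟩
      r + (c + m) ≡⟨ +-assoc r c m ⟨
      r + c + m   ≡⟨ cong (_+ m) (+-comm r c) ⟩
      c + r + m   ∎)
      where open ≡-Reasoning

nthNonPolygonal-floorSqrt : ∀ d {n s} → 1 ≤ d → 1 ≤ n → IsFloorSqrt (2 + d) n s →
                            NthSmallest (NonPolygonal (2 + d)) n (a (2 + d) n s)
nthNonPolygonal-floorSqrt d {n} {s} 1≤d 1≤n (lo , hi) with d * s * (s + 1) <? 2 * n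
... | yes above =
  subst (NthSmallest (NonPolygonal (2 + d)) n) (trans (+-suc n s) (+-comm 1 (n + s)))
    (nthNonPolygonal (2 + d) (suc s) n lower upper)
  where
  lower : gapSum d (suc s) < n
  lower = gapSum-suc< d s n (begin-strict
    d * (suc s * s)   ≡⟨ solve (d ∷ s ∷ []) ⟩
    d * s * (s + 1)   <⟨ above ⟩
    2 * n             ∎)
    where open ≤-Reasoning
  upper : n ≤ gapSum d (suc (suc s))
  upper = ≤gapSum-suc d (suc s) n (begin
    2 * n                     ≤⟨ <⇒≤ hi ⟩
    d * (suc s * suc s)       ≤⟨ *-monoʳ-≤ d (*-monoˡ-≤ (suc s) (n≤1+n (suc s))) ⟩
    d * (suc (suc s) * suc s) ∎)
    where open ≤-Reasoning
... | no ¬above with s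
...   | zero  = contradiction (≤-trans (m≤m+n n (n + 0)) 2n≤0) (<⇒≱ 1≤n)
  where
  2n≤0 : 2 * n ≤ 0
  2n≤0 = subst (λ z → 2 * n ≤ z * 1) (*-zeroʳ d) (≮⇒≥ ¬above)
...   | suc u = nthNonPolygonal (2 + d) (suc u) n lower upper
  where
  lower : gapSum d (suc u) < n
  lower = gapSum-suc< d u n (begin-strict
    d * (suc u * u)     <⟨ *-monoʳ-< d ⦃ >-nonZero 1≤d ⦄ (*-monoʳ-< (suc u) (n<1+n u)) ⟩
    d * (suc u * suc u) ≤⟨ lo ⟩
    2 * n               ∎)
    where open ≤-Reasoning
  upper : n ≤ gapSum d (suc (suc u))
  upper = ≤gapSum-suc d (suc u) n (begin
    2 * n                     ≤⟨ ≮⇒≥ ¬above ⟩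
    d * suc u * (suc u + 1)   ≡⟨ solve (d ∷ u ∷ []) ⟩
    d * (suc (suc u) * suc u) ∎)
    where open ≤-Reasoning

nthNonPolygonal-floorSqrtHalf : ∀ d {n t} → 1 ≤ d → d ≤ 8 → 1 ≤ n → IsFloorSqrtHalf (2 + d) n t →
                                NthSmallest (NonPolygonal (2 + d)) n (n + t)
nthNonPolygonal-floorSqrtHalf d {n} {zero} 1≤d d≤8 1≤n (_ , hi) = contradiction hi (≤⇒≯ (begin
  d * 1 ≡⟨ *-identityʳ d ⟩
  d     ≤⟨ d≤8 ⟩
  8 * 1 ≤⟨ *-monoʳ-≤ 8 1≤n ⟩
  8 * n ∎))
  where open ≤-Reasoning
nthNonPolygonal-floorSqrtHalf d {n} {suc u} 1≤d d≤8 1≤n (lo , hi) =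
  nthNonPolygonal (2 + d) (suc u) n lower upper
  where
  lower : gapSum d (suc u) < n
  lower = gapSum-suc< d u n (*-cancelˡ-< 4 _ _ (begin-strict
    4 * (d * (suc u * u))                   <⟨ m<m+n _ 1≤d ⟩
    4 * (d * (suc u * u)) + d               ≡⟨ solve (d ∷ u ∷ []) ⟩
    d * (suc (2 * u) * suc (2 * u))         ≡⟨ cong (λ z → d * (z * z)) (+-suc u (u + 0)) ⟨
    d * ((2 * suc u ∸ 1) * (2 * suc u ∸ 1)) ≤⟨ lo ⟩
    8 * n                                   ≡⟨ *-assoc 4 2 n ⟩
    4 * (2 * n)                             ∎))
    where open ≤-Reasoning
  g : ℕ
  g = gapSum d (suc (suc u))
  upper : n ≤ g
  upper = ≤-pred (*-cancelˡ-< 8 _ _ (begin-strict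
    8 * n                                   <⟨ hi ⟩
    d * ((2 * suc u + 1) * (2 * suc u + 1)) ≡⟨ solve (d ∷ u ∷ []) ⟩
    4 * (d * (suc (suc u) * suc u)) + d     ≡⟨ cong (λ z → 4 * z + d) (double-gapSum d (suc u)) ⟨
    4 * (2 * g) + d                         ≡⟨ cong (_+ d) (*-assoc 4 2 g) ⟨
    8 * g + d                               ≤⟨ +-monoʳ-≤ (8 * g) d≤8 ⟩
    8 * g + 8                               ≡⟨ +-comm (8 * g) 8 ⟩
    8 + 8 * g                               ≡⟨ *-suc 8 g ⟨
    8 * suc g                               ∎))
    where open ≤-Reasoning

theorem4 : (k : ℕ) → 3 ≤ k → (n : ℕ) → 1 ≤ n →
    ((s : ℕ) → IsFloorSqrt k n s → NthSmallest (NonPolygonal k) n (a k n s))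
    × (k ≤ 10 → (t : ℕ) → IsFloorSqrtHalf k n t → NthSmallest (NonPolygonal k) n (n + t))
theorem4 (suc (suc d)) (s≤s (s≤s 1≤d)) n 1≤n =
    (λ s → nthNonPolygonal-floorSqrt d 1≤d 1≤n)
  , λ { (s≤s (s≤s d≤8)) t → nthNonPolygonal-floorSqrtHalf d 1≤d d≤8 1≤n }
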